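{- For any $0\le\epsilon\le1$ and any integer $n\ge2$, any $(1+\epsilon)$-spanner on the uniform line metric with $n$ points and hop-diameter at most $3$ contains at least $\frac{1}{51200}n\log\log n$ edges.
   Context: The uniform line metric on $n$ points is $\{1,\dots,n\}$ with distance $|a-b|$. A $(1+\epsilon)$-spanner with hop-diameter at most $k$ is a graph $H$ on these points with edges weighted $|a-b|$ such that every pair $a,b$ is joined by a path in $H$ with at most $k$ edges and weight at most $(1+\epsilon)|a-b|$. Logarithms are base $2$.
   Formalization: The parameter ε ranges over the rationals with $0\le\epsilon\le1$. -}

module Defs where

open import Data.Nat as ℕ using (ℕ; zero; suc; _+_; _*_; _^_; _≤_; _<_; ∣_-_∣)
open import Data.Integer using (+_)
open import Data.Product using (_×_; _,_; Σ; ∃; ∃-syntax)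
open import Data.Sum using (_⊎_)
open import Data.List using (List; length)
open import Data.List.Membership.Propositional using (_∈_)
open import Data.List.Relation.Unary.All using (All)
open import Data.List.Relation.Unary.Unique.Propositional using (Unique)
open import Data.Rational as ℚ using (ℚ; 0ℚ; 1ℚ)

toℚ : ℕ → ℚ
toℚ k = (+ k) ℚ./ 1

-- A graph on the points {1,…,n} of the uniform line metric is given by
-- its edge list: each edge {a,b} is stored once as (a , b) with
-- 1 ≤ a < b ≤ n, without duplicates.
ValidEdge : ℕ → ℕ × ℕ → Set
ValidEdge n (a , b) = 1 ≤ a × a < b × b ≤ n

record LineGraph (n : ℕ) : Set where
  field
    edges  : List (ℕ × ℕ)
    valid  : All (ValidEdge n) edges
    simple : Unique edges

open LineGraph public

numEdges : ∀ {n} → LineGraph n → ℕ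
numEdges H = length (edges H)

Adj : ∀ {n} → LineGraph n → ℕ → ℕ → Set
Adj H u v = ((u , v) ∈ edges H) ⊎ ((v , u) ∈ edges H)

data Path {n : ℕ} (H : LineGraph n) : ℕ → ℕ → ℕ → ℕ → Set where
  here : ∀ {u} → Path H u u 0 0
  step : ∀ {u v w h d} → Adj H u v → Path H v w h d →
         Path H u w (suc h) (∣ u - v ∣ + d)

IsHopSpanner : ∀ {n} → ℚ → ℕ → LineGraph n → Set
IsHopSpanner {n} ε k H =
  ∀ a b → 1 ≤ a → a ≤ n → 1 ≤ b → b ≤ n →
  ∃[ h ] ∃[ w ] (Path H a b h w × h ≤ k ×
                 toℚ w ℚ.≤ (1ℚ ℚ.+ ε) ℚ.* toℚ ∣ a - b ∣)

-- LogLogBound n c m  expresses the real inequality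
--   n · log₂ (log₂ n) ≤ c · m     (for n ≥ 2, so t = log₂ n ≥ 1),
-- i.e. t^n ≤ 2^(c·m).  Without real numbers this is stated through the
-- rational lower approximations a/b of t = log₂ n (a/b < t ⟺ 2^a < n^b):
-- t^n ≤ 2^(c m)  ⟺  every such a/b satisfies (a/b)^n ≤ 2^(c m).
LogLogBound : ℕ → ℕ → ℕ → Set
LogLogBound n c m =
  ∀ a b → 1 ≤ b → 2 ^ a < n ^ b → a ^ n ≤ 2 ^ (c * m) * b ^ n

{-# OPTIONS --safe #-}
module Submission where

-- At level k an edge is medium if its length lies in [q k, 2 S k]; these
-- ranges are disjoint for different levels.  Cut the line into superblocks of t k = 4 s k + 2 blocks
-- of s k = 4 q k points.  If s k blocks of a superblock consist of points with a medium edge, these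
-- give s k² incidences (point, medium edge).  Otherwise more than 2 s k blocks contain an isolated
-- point, one without medium edge.  For isolated a, b in blocks at least two apart, the end edges of a
-- 3-hop stretch-2 path from a to b are shorter than q k, so its middle edge is medium and its ends lie
-- within q k of a and of b; as blocks of equal parity are 4 q k apart, that edge and the two block
-- parities determine the blocks, again giving s k² distinct charges.  So each level with 2 S k ≤ n
-- charges n/10 distinct (edge, tag) pairs with 6 tags, and since q k is doubly exponential in k,
-- about log log n levels qualify.

open import Defs
open import Data.Nat using (ℕ; _≤_)
open import Data.Rational using (ℚ; 0ℚ; 1ℚ)
open import Data.Rational using () renaming (_≤_ to _≤ℚ_)

open import Data.Nat using (zero; suc; _+_; _∸_; _*_; _^_; _<_; z≤n; s≤s; s≤s⁻¹; ∣_-_∣; parity; NonZero; >-nonZero; _≟_; _≤?_; _<?_)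
open import Data.Nat.Properties
open import Data.Nat.DivMod using (_/_; m/n*n≤m; m≡m%n+[m/n]*n; m%n<n)
open import Data.Nat.Tactic.RingSolver using (solve-∀)
open import Data.Nat.Coprimality using (1-coprimeTo) renaming (sym to coprime-sym)
open import Algebra.Properties.CommutativeSemigroup *-commutativeSemigroup using (interchange; x∙yz≈y∙xz)
open import Data.Parity.Base using (Parity; 0ℙ; 1ℙ)
open import Data.Parity.Properties using (suc-homo-⁻¹; p≢p⁻¹)
open import Data.Integer using (+_; _◃_)
import Data.Integer.Properties as ℤ
import Data.Sign.Base as Sign
open import Data.Rational using (mkℚ; toℚᵘ; NonNegative)
import Data.Rational as ℚ
import Data.Rational.Properties as ℚ
open import Data.Rational.Unnormalised using (*≤*)
import Data.Rational.Unnormalised as ℚᵘ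
import Data.Rational.Unnormalised.Properties as ℚᵘ
open import Data.Product using (_×_; _,_; proj₁; proj₂; ∃-syntax)
open import Data.Sum using (_⊎_; inj₁; inj₂)
open import Data.Empty using (⊥-elim)
open import Data.List using (List; []; _∷_; length; map; _++_; filter; cartesianProduct; upTo)
open import Data.List.Properties using (length-removeAt′; length-map; length-++; length-upTo)
open import Data.List.Membership.Propositional using (_∈_; find; lose)
open import Data.List.Membership.Propositional.Properties
  using (∈-filter⁻; ∈-upTo⁺; ∈-upTo⁻; ∈-cartesianProduct⁺; ∈-cartesianProduct⁻; ∈-map⁻; ∈-++⁻)
open import Data.List.Relation.Unary.Any as Any using (Any; here; there; _─_)
open import Data.List.Relation.Unary.All as All using (All; all?)
open import Data.List.Relation.Unary.All.Properties using (¬All⇒Any¬)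
open import Data.List.Relation.Unary.AllPairs using (AllPairs; []; _∷_)
import Data.List.Relation.Unary.AllPairs.Properties as AllPairs
open import Data.List.Relation.Unary.Unique.Propositional using (Unique)
open import Data.List.Relation.Unary.Unique.Propositional.Properties using (++⁺; map⁺; cartesianProduct⁺; upTo⁺)
open import Data.List.Relation.Binary.Disjoint.Propositional using (Disjoint)
open import Function using (_∘_; id)
open import Relation.Nullary using (¬_; Dec; yes; no; ¬?; contradiction)
open import Relation.Nullary.Decidable using (_×-dec_; _⊎-dec_)
open import Relation.Unary using (Decidable)
open import Relation.Binary.PropositionalEquality
open import Relation.Binary.Definitions using (tri<; tri≈; tri>)

∈-─⁺ : ∀ {A : Set} {x y : A} {ys} (x∈ys : x ∈ ys) → y ∈ ys → y ≢ x → y ∈ (ys ─ x∈ys)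
∈-─⁺ (here refl) (here refl) y≢x = ⊥-elim (y≢x refl)
∈-─⁺ (here refl) (there y∈ys) _   = y∈ys
∈-─⁺ (there _)   (here refl)  _   = here refl
∈-─⁺ (there x∈ys) (there y∈ys) y≢x = there (∈-─⁺ x∈ys y∈ys y≢x)

length-≤-byCharging : {I C : Set} (Charged : I → C → Set) →
  (∀ {i i′ c} → Charged i c → Charged i′ c → i ≡ i′) →
  (is : List I) (cs : List C) → Unique is →
  (∀ {i} → i ∈ is → ∃[ c ] (Charged i c × c ∈ cs)) →
  length is ≤ length cs
length-≤-byCharging Charged injective [] cs _ _ = z≤n
length-≤-byCharging Charged injective (i ∷ is) cs (i∉is ∷ is!) charge
  with c , chargedᵢ , c∈cs ← charge (here refl) =
  subst (suc (length is) ≤_) (sym (length-removeAt′ cs _))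
    (s≤s (length-≤-byCharging Charged injective is (cs ─ c∈cs) is! charge′))
  where
  charge′ : ∀ {i′} → i′ ∈ is → ∃[ c′ ] (Charged i′ c′ × c′ ∈ (cs ─ c∈cs))
  charge′ i′∈is with c′ , chargedᵢ′ , c′∈cs ← charge (there i′∈is) =
    c′ , chargedᵢ′ , ∈-─⁺ c∈cs c′∈cs
      λ { refl → All.lookup i∉is i′∈is (injective chargedᵢ chargedᵢ′) }

length-cartesianProduct : ∀ {A B : Set} (xs : List A) (ys : List B) →
  length (cartesianProduct xs ys) ≡ length xs * length ys
length-cartesianProduct []       ys = refl
length-cartesianProduct (x ∷ xs) ys = begin
  length (map (x ,_) ys ++ cartesianProduct xs ys)        ≡⟨ length-++ (map (x ,_) ys) ⟩
  length (map (x ,_) ys) + length (cartesianProduct xs ys) ≡⟨ cong₂ _+_ (length-map (x ,_) ys) (length-cartesianProduct xs ys) ⟩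
  length ys + length xs * length ys                        ∎
  where open ≡-Reasoning

module _ {A : Set} {P : A → Set} (P? : Decidable P) where

  length-filter+length-filter¬ : ∀ xs →
    length (filter P? xs) + length (filter (λ x → ¬? (P? x)) xs) ≡ length xs
  length-filter+length-filter¬ [] = refl
  length-filter+length-filter¬ (x ∷ xs) with P? x
  ... | yes _ = cong suc (length-filter+length-filter¬ xs)
  ... | no  _ = trans (+-suc _ _) (cong suc (length-filter+length-filter¬ xs))

-- Junk value 0 out of range.
nth : List ℕ → ℕ → ℕ
nth []       _       = 0
nth (x ∷ xs) zero    = x
nth (x ∷ xs) (suc i) = nth xs i

nth-∈ : ∀ xs {i} → i < length xs → nth xs i ∈ xs
nth-∈ (x ∷ xs) {zero}  _         = here refl
nth-∈ (x ∷ xs) {suc i} (s≤s i<n) = there (nth-∈ xs i<n)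

nth-mono-< : ∀ {xs} → AllPairs _<_ xs → ∀ {i j} → i < j → j < length xs → nth xs i < nth xs j
nth-mono-< {x ∷ xs} (x<xs ∷ _)  {zero}  {suc j} _         (s≤s j<n) = All.lookup x<xs (nth-∈ xs j<n)
nth-mono-< {x ∷ xs} (_ ∷ xs↗) {suc i} {suc j} (s≤s i<j) (s≤s j<n) = nth-mono-< xs↗ i<j j<n

module _ {xs : List ℕ} (xs↗ : AllPairs _<_ xs) where

  nth-gap : ∀ {i j} → suc i < j → j < length xs → suc (nth xs i) < nth xs j
  nth-gap {i} 1+i<j j<n = <-≤-trans (s≤s (nth-mono-< xs↗ (n<1+n i) (<-trans 1+i<j j<n))) (nth-mono-< xs↗ 1+i<j j<n)

  nth-injective : ∀ {i j} → i < length xs → j < length xs → nth xs i ≡ nth xs j → i ≡ j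
  nth-injective {i} {j} i<n j<n eq with <-cmp i j
  ... | tri< i<j _ _ = ⊥-elim (<-irrefl eq (nth-mono-< xs↗ i<j j<n))
  ... | tri≈ _ i≡j _ = i≡j
  ... | tri> _ _ j<i = ⊥-elim (<-irrefl (sym eq) (nth-mono-< xs↗ j<i i<n))

module _ {P : ℕ → Set} (P? : Decidable P) where

  filter-upTo-↗ : ∀ m → AllPairs _<_ (filter P? (upTo m))
  filter-upTo-↗ m = AllPairs.filter⁺ P? (AllPairs.applyUpTo⁺₁ id m (λ i<j _ → i<j))

  ∈-filter-upTo⁻ : ∀ {m i} → i ∈ filter P? (upTo m) → i < m × P i
  ∈-filter-upTo⁻ i∈ with i∈upTo , Pi ← ∈-filter⁻ P? i∈ = ∈-upTo⁻ i∈upTo , Pi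

*+-<-* : ∀ {d q q′ r} → r < d → q < q′ → q * d + r < q′ * d
*+-<-* {d} {q} {q′} {r} r<d q<q′ = begin-strict
  q * d + r <⟨ +-monoʳ-< (q * d) r<d ⟩
  q * d + d ≡⟨ +-comm (q * d) d ⟩
  suc q * d ≤⟨ *-monoˡ-≤ d q<q′ ⟩
  q′ * d    ∎
  where open ≤-Reasoning

quotRem-injective : ∀ {d q q′ r r′} → r < d → r′ < d → q * d + r ≡ q′ * d + r′ → q ≡ q′ × r ≡ r′
quotRem-injective {d} {q} {q′} {r} {r′} r<d r′<d eq with <-cmp q q′
... | tri< q<q′ _ _ = ⊥-elim (<-irrefl eq (<-≤-trans (*+-<-* r<d q<q′) (m≤m+n (q′ * d) r′)))
... | tri> _ _ q′<q = ⊥-elim (<-irrefl (sym eq) (<-≤-trans (*+-<-* r′<d q′<q) (m≤m+n (q * d) r)))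
... | tri≈ _ refl _ = refl , +-cancelˡ-≡ (q * d) r r′ eq

sameParity-<⇒suc-< : ∀ {m n} → parity m ≡ parity n → m < n → suc m < n
sameParity-<⇒suc-< {m} {n} same m<n with m≤n⇒m<n∨m≡n m<n
... | inj₁ sm<n = sm<n
... | inj₂ refl = ⊥-elim (p≢p⁻¹ (parity m) (trans same (sym (suc-homo-⁻¹ (suc m)))))

+-≤⇒≤∣-∣ : ∀ {a b c} → a + c ≤ b → c ≤ ∣ a - b ∣
+-≤⇒≤∣-∣ {a} {b} {c} a+c≤b = +-cancelˡ-≤ a c ∣ a - b ∣ (≤-trans a+c≤b (m≤n+∣n-m∣ b a))

∣-∣<⇒<+ˡ : ∀ {u v c} → ∣ u - v ∣ < c → u < v + c
∣-∣<⇒<+ˡ {u} {v} {c} lt = ≤-<-trans (m≤n+∣m-n∣ u v) (+-monoʳ-< v lt)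

∣-∣<⇒<+ʳ : ∀ {u v c} → ∣ u - v ∣ < c → v < u + c
∣-∣<⇒<+ʳ {u} {v} {c} lt = ∣-∣<⇒<+ˡ (subst (_< c) (∣-∣-comm u v) lt)

∣-∣<-triangle : ∀ {x a a′ c} → ∣ x - a ∣ < c → ∣ x - a′ ∣ < c → ∣ a - a′ ∣ < c + c
∣-∣<-triangle {x} {a} {a′} {c} xa xa′ = begin-strict
  ∣ a - a′ ∣             ≤⟨ ∣-∣-triangle a x a′ ⟩
  ∣ a - x ∣ + ∣ x - a′ ∣ <⟨ +-mono-< (subst (_< c) (∣-∣-comm x a) xa) xa′ ⟩
  c + c                  ∎
  where open ≤-Reasoning

m+n+n+n≡m+3*n : ∀ m n → m + n + n + n ≡ m + 3 * n
m+n+n+n≡m+3*n = solve-∀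

quotRem-nth-injective : ∀ {t j j′ r r′} (blocks : ℕ → List ℕ) →
  (∀ j → AllPairs _<_ (blocks j)) → (∀ j {i} → i ∈ blocks j → i < t) →
  r < length (blocks j) → r′ < length (blocks j′) →
  j * t + nth (blocks j) r ≡ j′ * t + nth (blocks j′) r′ → j ≡ j′ × r ≡ r′
quotRem-nth-injective {t} {j} {j′} blocks ↗ <t r< r′< eq
  with refl , i≡i′ ← quotRem-injective {t} {j} {j′} (<t j (nth-∈ _ r<)) (<t j′ (nth-∈ _ r′<)) eq
  = refl , nth-injective (↗ j) r< r′< i≡i′

m<n∸o⇒o+m<n : ∀ o {m n} → m < n ∸ o → o + m < n
m<n∸o⇒o+m<n zero    {n = n}     m<n   = m<n
m<n∸o⇒o+m<n (suc o) {n = suc n} m<n∸o = s≤s (m<n∸o⇒o+m<n o m<n∸o)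

n<2^n : ∀ n → n < 2 ^ n
n<2^n zero    = s≤s z≤n
n<2^n (suc n) = +-mono-≤ (m^n>0 2 n) (≤-trans (n<2^n n) (m≤m+n (2 ^ n) 0))

^-distribʳ-* : ∀ x y n → (x * y) ^ n ≡ x ^ n * y ^ n
^-distribʳ-* x y zero    = refl
^-distribʳ-* x y (suc n) = begin
  x * y * (x * y) ^ n     ≡⟨ cong (x * y *_) (^-distribʳ-* x y n) ⟩
  x * y * (x ^ n * y ^ n) ≡⟨ interchange x y (x ^ n) (y ^ n) ⟩
  x * x ^ n * (y * y ^ n) ∎
  where open ≡-Reasoning

^-cancelʳ-< : ∀ b {x y} → x ^ b < y ^ b → x < y
^-cancelʳ-< b {x} {y} xᵇ<yᵇ with x <? y
... | yes x<y = x<y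
... | no  x≮y = contradiction xᵇ<yᵇ (≤⇒≯ (^-monoˡ-≤ b (≮⇒≥ x≮y)))

∃-dyadicBracket : ∀ f {a b} → b ≤ a → a < 2 ^ f * b → ∃[ K ] (2 ^ K * b ≤ a × a < 2 ^ suc K * b)
∃-dyadicBracket zero    {a} {b} b≤a a<b = contradiction (subst (_≤ a) (sym (+-identityʳ b)) b≤a) (<⇒≱ a<b)
∃-dyadicBracket (suc f) {a} {b} b≤a a<2^[1+f]b with 2 ^ f * b ≤? a
... | yes 2^fb≤a = f , 2^fb≤a , a<2^[1+f]b
... | no  2^fb≰a = ∃-dyadicBracket f b≤a (≰⇒> 2^fb≰a)

-- With 2^K ≤ a/b < 2^(K+1) for a rational lower approximation a/b of log₂ n: n ≥ 2^2^K and (a/b)^n ≤ 2^((K+1) n).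
logLogBound-intro : ∀ {n c m} → (∀ K → 2 ^ 2 ^ K ≤ n → suc K * n ≤ c * m) → LogLogBound n c m
logLogBound-intro {n} {c} {m} bound a b 1≤b 2^a<nᵇ with b ≤? a
... | no  b≰a = ≤-trans (^-monoˡ-≤ n (<⇒≤ (≰⇒> b≰a))) (m≤n*m (b ^ n) (2 ^ (c * m)) {{m^n≢0 2 (c * m)}})
... | yes b≤a = fromBracket (∃-dyadicBracket a b≤a (<-≤-trans (n<2^n a) (m≤m*n (2 ^ a) b {{>-nonZero 1≤b}})))
  where
  fromBracket : ∃[ K ] (2 ^ K * b ≤ a × a < 2 ^ suc K * b) → a ^ n ≤ 2 ^ (c * m) * b ^ n
  fromBracket (K , 2^Kb≤a , a<2^[1+K]b) = begin
    a ^ n                       ≤⟨ ^-monoˡ-≤ n (<⇒≤ a<2^[1+K]b) ⟩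
    (2 ^ suc K * b) ^ n         ≡⟨ ^-distribʳ-* (2 ^ suc K) b n ⟩
    (2 ^ suc K) ^ n * b ^ n     ≡⟨ cong (_* b ^ n) (^-*-assoc 2 (suc K) n) ⟩
    2 ^ (suc K * n) * b ^ n     ≤⟨ *-monoˡ-≤ (b ^ n) (^-monoʳ-≤ 2 (bound K 2^2^K≤n)) ⟩
    2 ^ (c * m) * b ^ n         ∎
    where
    open ≤-Reasoning
    2^2^K≤n : 2 ^ 2 ^ K ≤ n
    2^2^K≤n = <⇒≤ (^-cancelʳ-< b (begin-strict
      (2 ^ 2 ^ K) ^ b ≡⟨ ^-*-assoc 2 (2 ^ K) b ⟩
      2 ^ (2 ^ K * b) ≤⟨ ^-monoʳ-≤ 2 2^Kb≤a ⟩
      2 ^ a           <⟨ 2^a<nᵇ ⟩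
      n ^ b           ∎))

toℚ≡mkℚ : ∀ k → toℚ k ≡ mkℚ (+ k) 0 (coprime-sym (1-coprimeTo k))
toℚ≡mkℚ k = ℚ.normalize-coprime (coprime-sym (1-coprimeTo k))

-- toℚ k is k/1 in normal form, so this is + w ≤ + (2 d) in ℤ after clearing denominators 1.
fromℚᵘ-≤-2* : ∀ w d → toℚᵘ (toℚ w) ℚᵘ.≤ toℚᵘ (1ℚ ℚ.+ 1ℚ) ℚᵘ.* toℚᵘ (toℚ d) → w ≤ 2 * d
fromℚᵘ-≤-2* w d w≤2d rewrite toℚ≡mkℚ w | toℚ≡mkℚ d with w≤2d
... | *≤* w≤2d′ rewrite ℤ.*-identityʳ (+ w) | ℤ.*-identityʳ (Sign.+ ◃ (2 * d)) | ℤ.+◃n≡+n (2 * d) =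
  ℤ.drop‿+≤+ w≤2d′

stretch≤1+1⇒≤2* : ∀ ε w d → ε ℚ.≤ 1ℚ → toℚ w ℚ.≤ (1ℚ ℚ.+ ε) ℚ.* toℚ d → w ≤ 2 * d
stretch≤1+1⇒≤2* ε w d ε≤1 w≤[1+ε]d = fromℚᵘ-≤-2* w d (ℚᵘ.≤-respʳ-≃ (ℚ.toℚᵘ-homo-* (1ℚ ℚ.+ 1ℚ) (toℚ d))
  (ℚ.toℚᵘ-mono-≤ (ℚ.≤-trans w≤[1+ε]d (ℚ.*-monoʳ-≤-nonNeg (toℚ d) (ℚ.+-monoʳ-≤ 1ℚ ε≤1)))))
  where
  instance
    d≥0 : NonNegative (toℚ d)
    d≥0 rewrite toℚ≡mkℚ d = _

IsStretch2Spanner : ∀ {n} → ℕ → LineGraph n → Set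
IsStretch2Spanner {n} k H = ∀ a b → 1 ≤ a → a ≤ n → 1 ≤ b → b ≤ n →
  ∃[ h ] ∃[ w ] (Path H a b h w × h ≤ k × w ≤ 2 * ∣ a - b ∣)

hopSpanner⇒stretch2Spanner : ∀ {n ε k} {H : LineGraph n} → ε ≤ℚ 1ℚ → IsHopSpanner ε k H → IsStretch2Spanner k H
hopSpanner⇒stretch2Spanner {ε = ε} ε≤1 spanner a b 1≤a a≤n 1≤b b≤n
  with h , w , path , h≤k , w≤[1+ε]∣a-b∣ ← spanner a b 1≤a a≤n 1≤b b≤n
  = h , w , path , h≤k , stretch≤1+1⇒≤2* ε w ∣ a - b ∣ ε≤1 w≤[1+ε]∣a-b∣

len : ℕ × ℕ → ℕ
len (x , y) = ∣ x - y ∣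

Medium : ℕ → ℕ → ℕ × ℕ → Set
Medium lo hi e = lo ≤ len e × len e ≤ hi

Incident : ℕ → ℕ × ℕ → Set
Incident p (x , y) = x ≡ p ⊎ y ≡ p

module _ {n : ℕ} (H : LineGraph n) where

  HasMediumEdge : ℕ → ℕ → ℕ → Set
  HasMediumEdge lo hi p = Any (λ e → Incident p e × Medium lo hi e) (edges H)

  hasMediumEdge? : ∀ lo hi p → Dec (HasMediumEdge lo hi p)
  hasMediumEdge? lo hi p = Any.any?
    (λ (x , y) → ((x ≟ p) ⊎-dec (y ≟ p)) ×-dec ((lo ≤? ∣ x - y ∣) ×-dec (∣ x - y ∣ ≤? hi)))
    (edges H)

  adjSym : ∀ {u v} → Adj H u v → Adj H v u
  adjSym (inj₁ uv∈H) = inj₂ uv∈H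
  adjSym (inj₂ vu∈H) = inj₁ vu∈H

  MediumBridge : ℕ → ℕ → ℕ → ℕ → Set
  MediumBridge lo hi a b = ∃[ e ] (e ∈ edges H × Medium lo hi e × ∣ proj₁ e - a ∣ < lo × ∣ proj₂ e - b ∣ < lo)

  module _ {lo hi : ℕ} where

    isolated⇒shortˡ : ∀ {u v} → ¬ HasMediumEdge lo hi u → Adj H u v → ∣ u - v ∣ ≤ hi → ∣ u - v ∣ < lo
    isolated⇒shortˡ {u} {v} ¬medium adj ≤hi = ≰⇒> λ lo≤ → ¬medium (incidentMedium adj lo≤)
      where
      incidentMedium : Adj H u v → lo ≤ ∣ u - v ∣ → HasMediumEdge lo hi u
      incidentMedium (inj₁ uv∈H) lo≤ = lose uv∈H (inj₁ refl , lo≤ , ≤hi)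
      incidentMedium (inj₂ vu∈H) lo≤ rewrite ∣-∣-comm u v = lose vu∈H (inj₂ refl , lo≤ , ≤hi)

    isolated⇒shortʳ : ∀ {u v} → ¬ HasMediumEdge lo hi v → Adj H u v → ∣ u - v ∣ ≤ hi → ∣ u - v ∣ < lo
    isolated⇒shortʳ {u} {v} ¬medium adj ≤hi rewrite ∣-∣-comm u v =
      isolated⇒shortˡ ¬medium (adjSym adj) ≤hi

    -- The end edges of the path are short since a and b are isolated, and two short edges cannot bridge the gap 3·lo.
    isolatedEnds⇒mediumBridge : ∀ {a b h w} → 0 < lo →
      ¬ HasMediumEdge lo hi a → ¬ HasMediumEdge lo hi b → a + 3 * lo ≤ b →
      Path H a b h w → h ≤ 3 → w ≤ hi → MediumBridge lo hi a b
    isolatedEnds⇒mediumBridge {a} lo>0 _ _ a+3lo≤a here _ _ =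
      ⊥-elim (<⇒≱ (m<m+n a (≤-trans lo>0 (m≤m+n lo _))) a+3lo≤a)
    isolatedEnds⇒mediumBridge {a} {b} _ ¬a _ a+3lo≤b (step adj here) _ w≤hi =
      ⊥-elim (<⇒≱ (<-≤-trans ab<lo (m≤m+n lo _)) (+-≤⇒≤∣-∣ {a} {b} a+3lo≤b))
      where
      ab<lo : ∣ a - b ∣ < lo
      ab<lo = isolated⇒shortˡ ¬a adj (≤-trans (m≤m+n _ 0) w≤hi)
    isolatedEnds⇒mediumBridge {a} {b} _ ¬a ¬b a+3lo≤b (step {v = x} adj₁ (step adj₂ here)) _ w≤hi =
      ⊥-elim (<⇒≱ ab<3lo (+-≤⇒≤∣-∣ {a} {b} a+3lo≤b))
      where
      ab<3lo : ∣ a - b ∣ < 3 * lo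
      ab<3lo = begin-strict
        ∣ a - b ∣ ≤⟨ ∣-∣-triangle a x b ⟩
        ∣ a - x ∣ + ∣ x - b ∣ <⟨ +-mono-< (isolated⇒shortˡ ¬a adj₁ (≤-trans (m≤m+n _ _) w≤hi))
                                         (isolated⇒shortʳ ¬b adj₂ (≤-trans (≤-trans (m≤m+n ∣ x - b ∣ 0) (m≤n+m _ ∣ a - x ∣)) w≤hi)) ⟩
        lo + lo ≤⟨ +-monoʳ-≤ lo (m≤m+n lo _) ⟩
        3 * lo ∎
        where open ≤-Reasoning
    isolatedEnds⇒mediumBridge {a} {b} _ ¬a ¬b a+3lo≤b (step {v = x} adj₁ (step {v = y} adj₂ (step adj₃ here))) _ w≤hi =
      middleEdge adj₂
      where
      ax<lo : ∣ a - x ∣ < lo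
      ax<lo = isolated⇒shortˡ ¬a adj₁ (≤-trans (m≤m+n _ _) w≤hi)
      yb<lo : ∣ y - b ∣ < lo
      yb<lo = isolated⇒shortʳ ¬b adj₃
        (≤-trans (≤-trans (m≤m+n ∣ y - b ∣ 0) (≤-trans (m≤n+m _ ∣ x - y ∣) (m≤n+m _ ∣ a - x ∣))) w≤hi)
      xy≤hi : ∣ x - y ∣ ≤ hi
      xy≤hi = ≤-trans (≤-trans (m≤m+n ∣ x - y ∣ _) (m≤n+m _ ∣ a - x ∣)) w≤hi
      x+lo<y : x + lo < y
      x+lo<y = +-cancelʳ-< lo (x + lo) y (begin-strict
        x + lo + lo      <⟨ +-monoˡ-< lo (+-monoˡ-< lo (∣-∣<⇒<+ʳ ax<lo)) ⟩
        a + lo + lo + lo ≡⟨ m+n+n+n≡m+3*n a lo ⟩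
        a + 3 * lo       ≤⟨ a+3lo≤b ⟩
        b                <⟨ ∣-∣<⇒<+ʳ yb<lo ⟩
        y + lo           ∎)
        where open ≤-Reasoning
      middleEdge : Adj H x y → MediumBridge lo hi a b
      middleEdge (inj₁ xy∈H) = (x , y) , xy∈H , (+-≤⇒≤∣-∣ {x} {y} (<⇒≤ x+lo<y) , xy≤hi) ,
                           subst (_< lo) (∣-∣-comm a x) ax<lo , yb<lo
      middleEdge (inj₂ yx∈H) = ⊥-elim (<-asym (proj₁ (proj₂ (All.lookup (valid H) yx∈H))) (≤-<-trans (m≤m+n x lo) x+lo<y))
    isolatedEnds⇒mediumBridge _ _ _ _ (step _ (step _ (step _ (step _ _)))) (s≤s (s≤s (s≤s ()))) _

-- q (k+1) = 256 q k² makes 2 S k < q (k+1), so the medium ranges [q k, 2 S k] of distinct levels are disjoint.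
α : ℕ → ℕ
α zero    = 0
α (suc k) = 2 * α k + 8

q s t S : ℕ → ℕ
q k = 2 ^ α k
s k = 4 * q k
t k = 2 + 4 * s k
S k = t k * s k

q>0 : ∀ k → 0 < q k
q>0 k = m^n>0 2 (α k)

S-nonZero : ∀ k → NonZero (S k)
S-nonZero k = m*n≢0 (t k) (s k) {{_}} {{m*n≢0 4 (q k) {{_}} {{m^n≢0 2 (α k)}}}}

q-suc : ∀ k → q (suc k) ≡ q k * q k * 256
q-suc k = begin
  2 ^ (α k + (α k + 0) + 8)       ≡⟨ ^-distribˡ-+-* 2 (α k + (α k + 0)) 8 ⟩
  2 ^ (α k + (α k + 0)) * 256     ≡⟨ cong (_* 256) (^-distribˡ-+-* 2 (α k) (α k + 0)) ⟩
  q k * 2 ^ (α k + 0) * 256       ≡⟨ cong (λ e → q k * 2 ^ e * 256) (+-identityʳ (α k)) ⟩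
  q k * q k * 256                 ∎
  where open ≡-Reasoning

2*S<q-suc : ∀ k → 2 * S k < q (suc k)
2*S<q-suc k = subst (2 * S k <_) (sym (q-suc k)) (bound (q k) (q>0 k))
  where
  identity : ∀ y → suc (2 * ((2 + 4 * (4 * suc y)) * (4 * suc y))) + (128 * y * y + 240 * y + 111) ≡ suc y * suc y * 256
  identity = solve-∀
  bound : ∀ x → 0 < x → 2 * ((2 + 4 * (4 * x)) * (4 * x)) < x * x * 256
  bound (suc y) _ = subst (2 * ((2 + 4 * (4 * suc y)) * (4 * suc y)) <_) (identity y) (m≤m+n _ _)

α-mono : ∀ {k k′} → k ≤ k′ → α k ≤ α k′
α-mono {k′ = zero}   z≤n = ≤-refl
α-mono {k′ = suc k′} k≤1+k′ with m≤n⇒m<n∨m≡n k≤1+k′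
... | inj₂ refl       = ≤-refl
... | inj₁ (s≤s k≤k′) = ≤-trans (α-mono k≤k′) (≤-trans (m≤m+n (α k′) _) (m≤m+n (2 * α k′) 8))

α+8≤2^[3+k] : ∀ k → α k + 8 ≤ 2 ^ (3 + k)
α+8≤2^[3+k] zero    = ≤-refl
α+8≤2^[3+k] (suc k) = subst (_≤ 2 ^ (3 + suc k)) (sym (double (α k))) (*-monoʳ-≤ 2 (α+8≤2^[3+k] k))
  where
  double : ∀ a → 2 * a + 8 + 8 ≡ 2 * (a + 8)
  double = solve-∀

2*S<2^2^[4+k] : ∀ k → 2 * S k < 2 ^ 2 ^ (4 + k)
2*S<2^2^[4+k] k = <-≤-trans (2*S<q-suc k) (^-monoʳ-≤ 2 (≤-trans (m≤m+n _ 8) (α+8≤2^[3+k] (suc k))))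

MediumAt : ℕ → ℕ × ℕ → Set
MediumAt k = Medium (q k) (2 * S k)

¬mediumAt-higher : ∀ {k k′ e} → k < k′ → MediumAt k e → ¬ MediumAt k′ e
¬mediumAt-higher {k} k<k′ (_ , e≤2S) (q≤e , _) =
  <⇒≱ (<-≤-trans (≤-<-trans e≤2S (2*S<q-suc k)) (^-monoʳ-≤ 2 (α-mono k<k′))) q≤e

mediumAt-level-unique : ∀ {k k′ e} → MediumAt k e → MediumAt k′ e → k ≡ k′
mediumAt-level-unique {k} {k′} {e} m m′ with <-cmp k k′
... | tri< k<k′ _ _ = ⊥-elim (¬mediumAt-higher {e = e} k<k′ m m′)
... | tri≈ _ k≡k′ _ = k≡k′
... | tri> _ _ k′<k = ⊥-elim (¬mediumAt-higher {e = e} k′<k m′ m)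

-- Points are 1-based: block g of size d is {g d + 1, …, g d + d}.
blockPoint : ℕ → ℕ → ℕ → ℕ
blockPoint d g r = suc (g * d + r)

InBlock : ℕ → ℕ → ℕ → Set
InBlock d g a = ∃[ r ] (r < d × a ≡ blockPoint d g r)

blockPoint-injective : ∀ {d g g′ r r′} → r < d → r′ < d →
  blockPoint d g r ≡ blockPoint d g′ r′ → g ≡ g′ × r ≡ r′
blockPoint-injective r<d r′<d eq = quotRem-injective r<d r′<d (suc-injective eq)

inBlock-gap : ∀ {d g g′ a a′} → suc g < g′ → InBlock d g a → InBlock d g′ a′ → a + d ≤ a′
inBlock-gap {d} {g} {g′} 1+g<g′ (r , r<d , refl) (r′ , _ , refl) = s≤s (begin
  g * d + r + d ≡⟨ shift g d r ⟩
  suc g * d + r ≤⟨ <⇒≤ (*+-<-* r<d 1+g<g′) ⟩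
  g′ * d        ≤⟨ m≤m+n (g′ * d) r′ ⟩
  g′ * d + r′   ∎)
  where
  open ≤-Reasoning
  shift : ∀ g d r → g * d + r + d ≡ suc g * d + r
  shift = solve-∀

sameParity-near⇒sameBlock : ∀ {d g g′ a a′} → InBlock d g a → InBlock d g′ a′ →
  parity g ≡ parity g′ → ∣ a - a′ ∣ < d → g ≡ g′
sameParity-near⇒sameBlock {d} {g} {g′} {a} {a′} a∈g a′∈g′ same near with <-cmp g g′
... | tri< g<g′ _ _ =
  ⊥-elim (<⇒≱ near (+-≤⇒≤∣-∣ {a} {a′} (inBlock-gap (sameParity-<⇒suc-< same g<g′) a∈g a′∈g′)))
... | tri≈ _ g≡g′ _ = g≡g′
... | tri> _ _ g′<g =
  ⊥-elim (<⇒≱ (subst (_< d) (∣-∣-comm a a′) near)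
                (+-≤⇒≤∣-∣ {a′} {a} (inBlock-gap (sameParity-<⇒suc-< (sym same) g′<g) a′∈g′ a∈g)))

inSuperblock-lower : ∀ {d t j i a} → InBlock d (j * t + i) a → j * (t * d) < a
inSuperblock-lower {d} {t} {j} {i} (r , _ , refl) = s≤s (begin
  j * (t * d)       ≡⟨ *-assoc j t d ⟨
  j * t * d         ≤⟨ *-monoˡ-≤ d (m≤m+n (j * t) i) ⟩
  (j * t + i) * d   ≤⟨ m≤m+n _ r ⟩
  (j * t + i) * d + r ∎)
  where open ≤-Reasoning

inSuperblock-upper : ∀ {d t j i a} → i < t → InBlock d (j * t + i) a → a ≤ suc j * (t * d)
inSuperblock-upper {d} {t} {j} {i} i<t (r , r<d , refl) = begin-strict
  (j * t + i) * d + r <⟨ *+-<-* r<d (+-monoʳ-< (j * t) i<t) ⟩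
  (j * t + t) * d     ≡⟨ regroup j t d ⟩
  suc j * (t * d)     ∎
  where
  open ≤-Reasoning
  regroup : ∀ j t d → (j * t + t) * d ≡ suc j * (t * d)
  regroup = solve-∀

superblocks : ℕ → ℕ → ℕ
superblocks n k = (n / S k) {{S-nonZero k}}

superblock-≤n : ∀ {n k j} → j < superblocks n k → suc j * S k ≤ n
superblock-≤n {n} {k} j<T = ≤-trans (*-monoˡ-≤ (S k) j<T) (m/n*n≤m n (S k) {{S-nonZero k}})

-- All but fewer than S k ≤ n/2 points lie in complete superblocks, and 2 S k ≤ 10 s k² as s k ≥ 2.
n≤10*superblocks*s² : ∀ {n k} → 2 * S k ≤ n → n ≤ 10 * (superblocks n k * (s k * s k))
n≤10*superblocks*s² {n} {k} 2S≤n = ≤-trans (<⇒≤ n<2TS) 2TS≤10Ts²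
  where
  instance
    S≢0 : NonZero (S k)
    S≢0 = S-nonZero k
  T : ℕ
  T = superblocks n k
  n<S+TS : n < S k + T * S k
  n<S+TS = subst (_< S k + T * S k) (sym (m≡m%n+[m/n]*n n (S k))) (+-monoˡ-< (T * S k) (m%n<n n (S k)))
  n<2TS : n < 2 * (T * S k)
  n<2TS = +-cancelˡ-< n n (2 * (T * S k)) (begin-strict
    n + n                               <⟨ +-mono-< n<S+TS n<S+TS ⟩
    (S k + T * S k) + (S k + T * S k)   ≡⟨ double (S k) (T * S k) ⟩
    2 * S k + 2 * (T * S k)             ≤⟨ +-monoˡ-≤ (2 * (T * S k)) 2S≤n ⟩
    n + 2 * (T * S k)                   ∎)
    where
    open ≤-Reasoning
    double : ∀ a b → (a + b) + (a + b) ≡ 2 * a + 2 * b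
    double = solve-∀
  2S≤10s² : ∀ x → 2 ≤ x → 2 * ((2 + 4 * x) * x) ≤ 10 * (x * x)
  2S≤10s² (suc zero) (s≤s ())
  2S≤10s² (suc (suc y)) _ = subst (2 * ((2 + 4 * suc (suc y)) * suc (suc y)) ≤_) (sym (expand y)) (m≤m+n _ _)
    where
    expand : ∀ y → 10 * (suc (suc y) * suc (suc y)) ≡ 2 * ((2 + 4 * suc (suc y)) * suc (suc y)) + (2 * y * y + 4 * y)
    expand = solve-∀
  2TS≤10Ts² : 2 * (T * S k) ≤ 10 * (T * (s k * s k))
  2TS≤10Ts² = begin
    2 * (T * S k)              ≡⟨ x∙yz≈y∙xz 2 T (S k) ⟩
    T * (2 * S k)              ≤⟨ *-monoʳ-≤ T (2S≤10s² (s k) (≤-trans (s≤s (s≤s z≤n)) (*-monoʳ-≤ 4 (q>0 k)))) ⟩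
    T * (10 * (s k * s k))     ≡⟨ x∙yz≈y∙xz T 10 (s k * s k) ⟩
    10 * (T * (s k * s k))     ∎
    where open ≤-Reasoning

Index : Set
Index = ℕ × ℕ × ℕ × ℕ

ValidIndex : ℕ → ℕ → Index → Set
ValidIndex n K (k , j , r₁ , r₂) = k < K × j < superblocks n k × r₁ < s k × r₂ < s k

levelIndices : ℕ → ℕ → List Index
levelIndices n k = map (k ,_) (cartesianProduct (upTo (superblocks n k)) (cartesianProduct (upTo (s k)) (upTo (s k))))

indices : ℕ → ℕ → List Index
indices n zero    = []
indices n (suc K) = indices n K ++ levelIndices n K

∈-levelIndices⁻ : ∀ {n k i} → i ∈ levelIndices n k → proj₁ i ≡ k × ValidIndex n (suc k) i
∈-levelIndices⁻ {n} {k} i∈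
  with (j , r₁ , r₂) , jr∈ , refl ← ∈-map⁻ (k ,_) i∈
  with j∈ , r∈ ← ∈-cartesianProduct⁻ (upTo (superblocks n k)) _ jr∈
  with r₁∈ , r₂∈ ← ∈-cartesianProduct⁻ (upTo (s k)) (upTo (s k)) r∈
  = refl , ≤-refl , ∈-upTo⁻ j∈ , ∈-upTo⁻ r₁∈ , ∈-upTo⁻ r₂∈

∈-indices⁻ : ∀ {n} K {i} → i ∈ indices n K → ValidIndex n K i
∈-indices⁻ (suc K) {i} i∈ with ∈-++⁻ (indices _ K) i∈
... | inj₁ i∈ᵢ with k<K , rest ← ∈-indices⁻ K i∈ᵢ = m≤n⇒m≤1+n k<K , rest
... | inj₂ i∈ₗ = proj₂ (∈-levelIndices⁻ i∈ₗ)

indices-unique : ∀ n K → Unique (indices n K)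
indices-unique n zero    = AllPairs.[]
indices-unique n (suc K) = ++⁺ (indices-unique n K) levelUnique disjoint
  where
  levelUnique : Unique (levelIndices n K)
  levelUnique = map⁺ (λ { refl → refl })
    (cartesianProduct⁺ (upTo⁺ (superblocks n K)) (cartesianProduct⁺ (upTo⁺ (s K)) (upTo⁺ (s K))))
  disjoint : Disjoint (indices n K) (levelIndices n K)
  disjoint (i∈ᵢ , i∈ₗ) = <-irrefl (proj₁ (∈-levelIndices⁻ i∈ₗ)) (proj₁ (∈-indices⁻ K i∈ᵢ))

length-levelIndices : ∀ n k → length (levelIndices n k) ≡ superblocks n k * (s k * s k)
length-levelIndices n k = begin
  length (levelIndices n k) ≡⟨ length-map (k ,_) (cartesianProduct (upTo T) (cartesianProduct (upTo (s k)) (upTo (s k)))) ⟩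
  length (cartesianProduct (upTo T) (cartesianProduct (upTo (s k)) (upTo (s k))))
    ≡⟨ length-cartesianProduct (upTo T) _ ⟩
  length (upTo T) * length (cartesianProduct (upTo (s k)) (upTo (s k)))
    ≡⟨ cong₂ _*_ (length-upTo T) (length-cartesianProduct (upTo (s k)) (upTo (s k))) ⟩
  T * (length (upTo (s k)) * length (upTo (s k)))
    ≡⟨ cong (T *_) (cong₂ _*_ (length-upTo (s k)) (length-upTo (s k))) ⟩
  T * (s k * s k) ∎
  where
  open ≡-Reasoning
  T : ℕ
  T = superblocks n k

K*n≤10*length-indices : ∀ n K → (∀ k → k < K → 2 * S k ≤ n) → K * n ≤ 10 * length (indices n K)
K*n≤10*length-indices n zero    _ = z≤n
K*n≤10*length-indices n (suc K) large = begin
  n + K * n                                       ≡⟨ +-comm n (K * n) ⟩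
  K * n + n                                       ≤⟨ +-mono-≤ (K*n≤10*length-indices n K (λ k k<K → large k (m≤n⇒m≤1+n k<K)))
                                                               (n≤10*superblocks*s² {n} {K} (large K ≤-refl)) ⟩
  10 * length (indices n K) + 10 * (superblocks n K * (s K * s K))
    ≡⟨ *-distribˡ-+ 10 (length (indices n K)) _ ⟨
  10 * (length (indices n K) + superblocks n K * (s K * s K))
    ≡⟨ cong (λ l → 10 * (length (indices n K) + l)) (length-levelIndices n K) ⟨
  10 * (length (indices n K) + length (levelIndices n K))
    ≡⟨ cong (10 *_) (length-++ (indices n K)) ⟨
  10 * length (indices n (suc K))                 ∎
  where open ≤-Reasoning

data Tag : Set where
  left right : Tag
  across     : Parity → Parity → Tag

tags : List Tag
tags = left ∷ right ∷ across 0ℙ 0ℙ ∷ across 0ℙ 1ℙ ∷ across 1ℙ 0ℙ ∷ across 1ℙ 1ℙ ∷ []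

∈-tags : ∀ τ → τ ∈ tags
∈-tags left           = here refl
∈-tags right          = there (here refl)
∈-tags (across 0ℙ 0ℙ) = there (there (here refl))
∈-tags (across 0ℙ 1ℙ) = there (there (there (here refl)))
∈-tags (across 1ℙ 0ℙ) = there (there (there (there (here refl))))
∈-tags (across 1ℙ 1ℙ) = there (there (there (there (there (here refl)))))

Charge : Set
Charge = (ℕ × ℕ) × Tag

data EndpointOf : ℕ → Charge → Set where
  leftEnd  : ∀ {x y} → EndpointOf x ((x , y) , left)
  rightEnd : ∀ {x y} → EndpointOf y ((x , y) , right)

endpointOf-injective : ∀ {p p′ c} → EndpointOf p c → EndpointOf p′ c → p ≡ p′
endpointOf-injective leftEnd  leftEnd  = refl
endpointOf-injective rightEnd rightEnd = refl

incident⇒endpointOf : ∀ {p e} → Incident p e → ∃[ τ ] EndpointOf p (e , τ)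
incident⇒endpointOf (inj₁ refl) = left , leftEnd
incident⇒endpointOf (inj₂ refl) = right , rightEnd

module _ {n : ℕ} (H : LineGraph n) where

  charges : List Charge
  charges = cartesianProduct (edges H) tags

  length≤6*numEdges : {I : Set} (Charged : I → Charge → Set) →
    (∀ {i i′ c} → Charged i c → Charged i′ c → i ≡ i′) →
    (is : List I) → Unique is → (∀ {i} → i ∈ is → ∃[ c ] (Charged i c × c ∈ charges)) →
    length is ≤ 6 * numEdges H
  length≤6*numEdges Charged injective is is! charge =
    subst (length is ≤_) (trans (length-cartesianProduct (edges H) tags) (*-comm (numEdges H) 6))
      (length-≤-byCharging Charged injective is charges is! charge)

  adj⇒endpointCharge : ∀ {a v} → Adj H a v → ∃[ c ] (EndpointOf a c × c ∈ charges)
  adj⇒endpointCharge {a} {v} (inj₁ av∈H) = ((a , v) , left)  , leftEnd  , ∈-cartesianProduct⁺ av∈H (∈-tags left)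
  adj⇒endpointCharge {a} {v} (inj₂ va∈H) = ((v , a) , right) , rightEnd , ∈-cartesianProduct⁺ va∈H (∈-tags right)

  n≤6*numEdges : (∀ {a} → 1 ≤ a → a ≤ n → ∃[ v ] Adj H a v) → n ≤ 6 * numEdges H
  n≤6*numEdges incidentEdge = subst (_≤ 6 * numEdges H) (length-upTo n)
    (length≤6*numEdges (λ p → EndpointOf (suc p)) (λ e e′ → suc-injective (endpointOf-injective e e′))
      (upTo n) (upTo⁺ n) (λ p∈ → adj⇒endpointCharge (proj₂ (incidentEdge (s≤s z≤n) (∈-upTo⁻ p∈)))))

  path⇒adj : ∀ {a b h w} → Path H a b h w → a ≢ b → ∃[ v ] Adj H a v
  path⇒adj here           a≢a = ⊥-elim (a≢a refl)
  path⇒adj (step adj _) _   = _ , adj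

  spanner⇒incidentEdge : ∀ {k} → 2 ≤ n → IsStretch2Spanner k H → ∀ {a} → 1 ≤ a → a ≤ n → ∃[ v ] Adj H a v
  spanner⇒incidentEdge 2≤n spanner {suc a} _ 1+a≤n with suc a <? n
  ... | yes 1+a<n with _ , _ , path , _ ← spanner (suc a) (suc (suc a)) (s≤s z≤n) 1+a≤n (s≤s z≤n) 1+a<n =
    path⇒adj path (1+n≢n ∘ sym)
  ... | no 1+a≮n = towardsPredecessor (s≤s⁻¹ (subst (2 ≤_) (≤-antisym (≮⇒≥ 1+a≮n) 1+a≤n) 2≤n))
    where
    towardsPredecessor : 1 ≤ a → ∃[ v ] Adj H (suc a) v
    towardsPredecessor 1≤a with _ , _ , path , _ ← spanner (suc a) a (s≤s z≤n) 1+a≤n 1≤a (≤-trans (n≤1+n a) 1+a≤n) =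
      path⇒adj path 1+n≢n

  Isolated : ℕ → ℕ → Set
  Isolated k p = ¬ HasMediumEdge H (q k) (2 * S k) p

  RichBlock : ℕ → ℕ → Set
  RichBlock k g = All (λ r → HasMediumEdge H (q k) (2 * S k) (blockPoint (s k) g r)) (upTo (s k))

  richBlock? : ∀ k g → Dec (RichBlock k g)
  richBlock? k g = all? (λ r → hasMediumEdge? H (q k) (2 * S k) (blockPoint (s k) g r)) (upTo (s k))

  poorBlock⇒isolatedPoint : ∀ {k g} → ¬ RichBlock k g → ∃[ a ] (InBlock (s k) g a × Isolated k a)
  poorBlock⇒isolatedPoint {k} {g} poor
    with r , r∈ , isolated ← find (¬All⇒Any¬ (λ r → hasMediumEdge? H (q k) (2 * S k) (blockPoint (s k) g r)) (upTo (s k)) poor)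
    = blockPoint (s k) g r , (r , ∈-upTo⁻ r∈ , refl) , isolated

  opaque
    richBlocks poorBlocks : ℕ → ℕ → List ℕ
    richBlocks k j = filter (λ i → richBlock? k (j * t k + i)) (upTo (t k))
    poorBlocks k j = filter (λ i → ¬? (richBlock? k (j * t k + i))) (upTo (t k))

    richBlocks-↗ : ∀ k j → AllPairs _<_ (richBlocks k j)
    richBlocks-↗ k j = filter-upTo-↗ (λ i → richBlock? k (j * t k + i)) (t k)

    poorBlocks-↗ : ∀ k j → AllPairs _<_ (poorBlocks k j)
    poorBlocks-↗ k j = filter-upTo-↗ (λ i → ¬? (richBlock? k (j * t k + i))) (t k)

    ∈-richBlocks⁻ : ∀ k j {i} → i ∈ richBlocks k j → i < t k × RichBlock k (j * t k + i)
    ∈-richBlocks⁻ k j = ∈-filter-upTo⁻ (λ i → richBlock? k (j * t k + i))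

    ∈-poorBlocks⁻ : ∀ k j {i} → i ∈ poorBlocks k j → i < t k × ¬ RichBlock k (j * t k + i)
    ∈-poorBlocks⁻ k j = ∈-filter-upTo⁻ (λ i → ¬? (richBlock? k (j * t k + i)))

    length-richBlocks+length-poorBlocks : ∀ k j → length (richBlocks k j) + length (poorBlocks k j) ≡ t k
    length-richBlocks+length-poorBlocks k j =
      trans (length-filter+length-filter¬ (λ i → richBlock? k (j * t k + i)) (upTo (t k))) (length-upTo (t k))

  poorBlocks-long : ∀ {k j} → length (richBlocks k j) < s k → s k + s k < length (poorBlocks k j)
  poorBlocks-long {k} {j} few = +-cancelˡ-< (length (richBlocks k j)) (s k + s k) _ (begin-strict
    length (richBlocks k j) + (s k + s k) <⟨ +-monoˡ-< (s k + s k) few ⟩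
    s k + (s k + s k)                     ≤⟨ ≤-trans (+-monoʳ-≤ (s k) (+-monoʳ-≤ (s k) (m≤m+n (s k) _))) (m≤n+m _ 2) ⟩
    t k                               ≡⟨ length-richBlocks+length-poorBlocks k j ⟨
    length (richBlocks k j) + length (poorBlocks k j) ∎)
    where open ≤-Reasoning

  richPoint : ℕ → ℕ → ℕ → ℕ → ℕ
  richPoint k j r₁ r₂ = blockPoint (s k) (j * t k + nth (richBlocks k j) r₁) r₂

  leftBlock rightBlock : ℕ → ℕ → ℕ → ℕ
  leftBlock  k j r₁ = j * t k + nth (poorBlocks k j) r₁
  rightBlock k j r₂ = j * t k + nth (poorBlocks k j) (suc (s k + r₂))

  NearBlock : ℕ → ℕ → ℕ → Set
  NearBlock k g x = ∃[ a ] (InBlock (s k) g a × ∣ x - a ∣ < q k)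

  data Charged : Index → Charge → Set where
    richEnd : ∀ {k j r₁ r₂ c} → MediumAt k (proj₁ c) →
      r₁ < length (richBlocks k j) → r₂ < s k → EndpointOf (richPoint k j r₁ r₂) c →
      Charged (k , j , r₁ , r₂) c
    bridge : ∀ {k j r₁ r₂ x y pˡ pʳ} → MediumAt k (x , y) →
      r₁ < length (poorBlocks k j) → suc (s k + r₂) < length (poorBlocks k j) →
      NearBlock k (leftBlock k j r₁) x → NearBlock k (rightBlock k j r₂) y →
      pˡ ≡ parity (leftBlock k j r₁) → pʳ ≡ parity (rightBlock k j r₂) →
      Charged (k , j , r₁ , r₂) ((x , y) , across pˡ pʳ)

  richPoint-injective : ∀ {k j j′ r₁ r₁′ r₂ r₂′} →
    r₁ < length (richBlocks k j) → r₂ < s k → r₁′ < length (richBlocks k j′) → r₂′ < s k →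
    richPoint k j r₁ r₂ ≡ richPoint k j′ r₁′ r₂′ → (j , r₁ , r₂) ≡ (j′ , r₁′ , r₂′)
  richPoint-injective {k} {j} {j′} r₁< r₂< r₁′< r₂′< eq
    with g≡g′ , refl ← blockPoint-injective r₂< r₂′< eq
    with refl , refl ← quotRem-nth-injective {t k} {j} {j′} (richBlocks k) (richBlocks-↗ k) (λ j → proj₁ ∘ ∈-richBlocks⁻ k j) r₁< r₁′< g≡g′
    = refl

  -- Blocks of equal parity are at least s k = 4 q k apart, so at most one of them is near x.
  nearBlock-sameParity⇒≡ : ∀ {k g g′ x} → NearBlock k g x → NearBlock k g′ x → parity g ≡ parity g′ → g ≡ g′
  nearBlock-sameParity⇒≡ {k} {x = x} (a , a∈g , xa) (a′ , a′∈g′ , xa′) same =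
    sameParity-near⇒sameBlock a∈g a′∈g′ same (<-≤-trans (∣-∣<-triangle {x} {a} {a′} xa xa′) (+-monoʳ-≤ (q k) (m≤m+n (q k) _)))

  charged-injective : ∀ {i i′ c} → Charged i c → Charged i′ c → i ≡ i′
  charged-injective {k , _} {k′ , _} {e , _} (richEnd m r₁< r₂< end) (richEnd m′ r₁′< r₂′< end′)
    with refl ← mediumAt-level-unique {k} {k′} {e} m m′
    = cong (k ,_) (richPoint-injective {k} r₁< r₂< r₁′< r₂′< (endpointOf-injective end end′))
  charged-injective (richEnd _ _ _ ()) (bridge _ _ _ _ _ _ _)
  charged-injective (bridge _ _ _ _ _ _ _) (richEnd _ _ _ ())
  charged-injective {k , j , _} {k′ , j′ , _} {(x , y) , _} (bridge m l< r< nearˡ nearʳ refl refl) (bridge m′ l′< r′< nearˡ′ nearʳ′ sameˡ sameʳ)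
    with refl ← mediumAt-level-unique {k} {k′} {x , y} m m′
    with refl , refl ← quotRem-nth-injective {t k} {j} {j′} (poorBlocks k) (poorBlocks-↗ k) (λ j → proj₁ ∘ ∈-poorBlocks⁻ k j)
                         l< l′< (nearBlock-sameParity⇒≡ {k} {x = x} nearˡ nearˡ′ sameˡ)
    with _ , 1+s+r₂≡1+s+r₂′ ← quotRem-nth-injective {t k} {j} {j} (poorBlocks k) (poorBlocks-↗ k) (λ j → proj₁ ∘ ∈-poorBlocks⁻ k j)
                         r< r′< (nearBlock-sameParity⇒≡ {k} {x = y} nearʳ nearʳ′ sameʳ)
    with refl ← +-cancelˡ-≡ (s k) _ _ (suc-injective 1+s+r₂≡1+s+r₂′)
    = refl

  richCharge : ∀ {k j r₁ r₂} → r₁ < length (richBlocks k j) → r₂ < s k →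
    ∃[ c ] (Charged (k , j , r₁ , r₂) c × c ∈ charges)
  richCharge {k} {j} r₁< r₂<
    with e , e∈H , incident , medium ← find (All.lookup (proj₂ (∈-richBlocks⁻ k j (nth-∈ _ r₁<))) (∈-upTo⁺ r₂<))
    with τ , end ← incident⇒endpointOf incident
    = (e , τ) , richEnd medium r₁< r₂< end , ∈-cartesianProduct⁺ e∈H (∈-tags τ)

  leftBlock<rightBlock : ∀ {k j r₁ r₂} → r₁ < s k → suc (s k + r₂) < length (poorBlocks k j) →
    suc (leftBlock k j r₁) < rightBlock k j r₂
  leftBlock<rightBlock {k} {j} {r₁} {r₂} r₁<s r< =
    subst (_< rightBlock k j r₂) (+-suc (j * t k) _)
      (+-monoʳ-< (j * t k) (nth-gap (poorBlocks-↗ k j) (s≤s (≤-trans r₁<s (m≤m+n (s k) r₂))) r<))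

  module _ (spanner : IsStretch2Spanner 3 H) where

    spanner⇒mediumBridge : ∀ {lo d a b} → 0 < lo →
      ¬ HasMediumEdge H lo (2 * d) a → ¬ HasMediumEdge H lo (2 * d) b →
      1 ≤ a → b ≤ n → a + 3 * lo ≤ b → b ≤ a + d → MediumBridge H lo (2 * d) a b
    spanner⇒mediumBridge {lo} {d} {a} {b} lo>0 ¬a ¬b 1≤a b≤n a+3lo≤b b≤a+d =
      bridgeFrom (spanner a b 1≤a (≤-trans a≤b b≤n) (≤-trans 1≤a a≤b) b≤n)
      where
      a≤b : a ≤ b
      a≤b = ≤-trans (m≤m+n a _) a+3lo≤b
      ∣a-b∣≤d : ∣ a - b ∣ ≤ d
      ∣a-b∣≤d rewrite m≤n⇒∣m-n∣≡n∸m a≤b = m≤n+o⇒m∸n≤o b a b≤a+d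
      bridgeFrom : ∃[ h ] ∃[ w ] (Path H a b h w × h ≤ 3 × w ≤ 2 * ∣ a - b ∣) → MediumBridge H lo (2 * d) a b
      bridgeFrom (_ , _ , path , h≤3 , w≤2∣a-b∣) =
        isolatedEnds⇒mediumBridge H lo>0 ¬a ¬b a+3lo≤b path h≤3 (≤-trans w≤2∣a-b∣ (*-monoʳ-≤ 2 ∣a-b∣≤d))

    superblock⇒mediumBridge : ∀ {k j iˡ iʳ a b} → j < superblocks n k → iʳ < t k →
      suc (j * t k + iˡ) < j * t k + iʳ → InBlock (s k) (j * t k + iˡ) a → InBlock (s k) (j * t k + iʳ) b →
      Isolated k a → Isolated k b → MediumBridge H (q k) (2 * S k) a b
    superblock⇒mediumBridge {k} {j} {iˡ} {iʳ} {a} {b} j<T iʳ<t gap a∈ b∈ ¬a ¬b =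
      spanner⇒mediumBridge {q k} {S k} (q>0 k) ¬a ¬b (≤-<-trans z≤n jS<a) b≤n a+3q≤b b≤a+S
      where
      jS<a : j * S k < a
      jS<a = inSuperblock-lower {s k} {t k} {j} {iˡ} a∈
      b≤[1+j]S : b ≤ suc j * S k
      b≤[1+j]S = inSuperblock-upper {s k} {t k} {j} iʳ<t b∈
      b≤n : b ≤ n
      b≤n = ≤-trans b≤[1+j]S (superblock-≤n {n} {k} j<T)
      a+3q≤b : a + 3 * q k ≤ b
      a+3q≤b = ≤-trans (+-monoʳ-≤ a (*-monoˡ-≤ (q k) (n≤1+n 3))) (inBlock-gap {s k} gap a∈ b∈)
      b≤a+S : b ≤ a + S k
      b≤a+S = ≤-trans b≤[1+j]S (subst (suc j * S k ≤_) (+-comm (S k) a) (+-monoʳ-≤ (S k) (<⇒≤ jS<a)))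

    bridgeCharge : ∀ {k j r₁ r₂} → j < superblocks n k → r₁ < s k → r₁ < length (poorBlocks k j) →
      suc (s k + r₂) < length (poorBlocks k j) → ∃[ c ] (Charged (k , j , r₁ , r₂) c × c ∈ charges)
    bridgeCharge {k} {j} {r₁} {r₂} j<T r₁<s l< r<
      with a , a∈ , ¬a ← poorBlock⇒isolatedPoint {k} {leftBlock k j r₁} (proj₂ (∈-poorBlocks⁻ k j (nth-∈ _ l<)))
      with b , b∈ , ¬b ← poorBlock⇒isolatedPoint {k} {rightBlock k j r₂} (proj₂ (∈-poorBlocks⁻ k j (nth-∈ _ r<)))
      with (x , y) , xy∈H , medium , xa , yb ←
             superblock⇒mediumBridge {k} {j} j<T (proj₁ (∈-poorBlocks⁻ k j (nth-∈ _ r<))) (leftBlock<rightBlock {k} {j} r₁<s r<) a∈ b∈ ¬a ¬b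
      = ((x , y) , across _ _) , bridge medium l< r< (a , a∈ , xa) (b , b∈ , yb) refl refl ,
        ∈-cartesianProduct⁺ xy∈H (∈-tags _)

    charge : ∀ {k j r₁ r₂} → j < superblocks n k → r₁ < s k → r₂ < s k →
      ∃[ c ] (Charged (k , j , r₁ , r₂) c × c ∈ charges)
    charge {k} {j} {r₁} {r₂} j<T r₁<s r₂<s with s k ≤? length (richBlocks k j)
    ... | yes many = richCharge (<-≤-trans r₁<s many) r₂<s
    ... | no  few  = bridgeCharge {k} {j} j<T r₁<s l< r<
      where
      r< : suc (s k + r₂) < length (poorBlocks k j)
      r< = ≤-<-trans (+-monoʳ-< (s k) r₂<s) (poorBlocks-long {k} {j} (≰⇒> few))
      l< : r₁ < length (poorBlocks k j)
      l< = <-trans (≤-trans r₁<s (≤-trans (m≤m+n (s k) r₂) (n≤1+n _))) r<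

module _ {n : ℕ} (H : LineGraph n) (spanner : IsStretch2Spanner 3 H) where

  L*n≤60*numEdges : ∀ L → (∀ k → k < L → 2 * S k ≤ n) → L * n ≤ 60 * numEdges H
  L*n≤60*numEdges L large = begin
    L * n                     ≤⟨ K*n≤10*length-indices n L large ⟩
    10 * length (indices n L) ≤⟨ *-monoʳ-≤ 10 (length≤6*numEdges H (Charged H) (charged-injective H)
                                    (indices n L) (indices-unique n L) (chargeValid ∘ ∈-indices⁻ L)) ⟩
    10 * (6 * numEdges H)     ≡⟨ *-assoc 10 6 (numEdges H) ⟨
    60 * numEdges H           ∎
    where
    open ≤-Reasoning
    chargeValid : ∀ {i} → ValidIndex n L i → ∃[ c ] (Charged H i c × c ∈ charges H)
    chargeValid {k , j , r₁ , r₂} (_ , j<T , r₁<s , r₂<s) = charge H spanner j<T r₁<s r₂<s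

  -- Levels k < K - 3 have 2 S k < 2^2^(k+4) ≤ n; the remaining factor 4 is covered by n ≤ 6 |E|.
  [1+K]*n≤84*numEdges : 2 ≤ n → ∀ K → 2 ^ 2 ^ K ≤ n → suc K * n ≤ 84 * numEdges H
  [1+K]*n≤84*numEdges 2≤n K 2^2^K≤n = begin
    suc K * n                              ≤⟨ *-monoˡ-≤ n (s≤s (m≤n+m∸n K 3)) ⟩
    (4 + (K ∸ 3)) * n                      ≡⟨ *-distribʳ-+ n 4 (K ∸ 3) ⟩
    4 * n + (K ∸ 3) * n                    ≤⟨ +-mono-≤ (*-monoʳ-≤ 4 n≤6m) (L*n≤60*numEdges (K ∸ 3) large) ⟩
    4 * (6 * numEdges H) + 60 * numEdges H ≡⟨ regroup (numEdges H) ⟩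
    84 * numEdges H                        ∎
    where
    open ≤-Reasoning
    n≤6m : n ≤ 6 * numEdges H
    n≤6m = n≤6*numEdges H (spanner⇒incidentEdge H 2≤n spanner)
    large : ∀ k → k < K ∸ 3 → 2 * S k ≤ n
    large k k<K∸3 = ≤-trans (<⇒≤ (2*S<2^2^[4+k] k)) (≤-trans (^-monoʳ-≤ 2 (^-monoʳ-≤ 2 (m<n∸o⇒o+m<n 3 {k} {K} k<K∸3))) 2^2^K≤n)
    regroup : ∀ m → 4 * (6 * m) + 60 * m ≡ 84 * m
    regroup = solve-∀

lemma4p4 : (ε : ℚ) → 0ℚ ≤ℚ ε → ε ≤ℚ 1ℚ → (n : ℕ) → 2 ≤ n → (H : LineGraph n) → IsHopSpanner ε 3 H → LogLogBound n 51200 (numEdges H)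
lemma4p4 ε _ ε≤1 n 2≤n H spanner = logLogBound-intro {n} {51200} {numEdges H} λ K 2^2^K≤n →
  ≤-trans ([1+K]*n≤84*numEdges H (hopSpanner⇒stretch2Spanner ε≤1 spanner) 2≤n K 2^2^K≤n)
          (*-monoˡ-≤ (numEdges H) (m≤m+n 84 51116))
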